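{- Let $\mathbb{F}$ be a field, $T\in\mathbb{F}^{n_0\times\dots\times n_{D-1}}$ a concise tensor, and $R,r$ integers with $n_0\le r\le R$. For $1\le d<D$ let $B_d\in\mathbb{F}^{n_d\times (r-n_0)}$ be given. Suppose there exists a rank-$R$ CPD $T=[\![A_0,\dots,A_{D-1}]\!]$ with $A_d\in\mathbb{F}^{n_d\times R}$ such that $(A_0)_{:,:n_0}$ is invertible and $(A_d)_{:,n_0:r}=B_d$ for all $1\le d<D$. Let $T'\in\mathbb{F}^{r\times n_1\times\dots\times n_{D-1}}$ be the tensor with $T'_{:n_0,:,\dots}=T$ and $T'_{r',:,\dots}=-\bigotimes_{d\ge 1}(B_d)_{:,r'-n_0}$ for $n_0\le r'<r$. Then the set \[S':=\{v\in\mathbb{F}^{1\times r}:\ \operatorname{rk}(v\times_0 T')\le R-r+1\}\] contains $n_0$ vectors $v_0,\dots,v_{n_0-1}$ such that the $n_0\times n_0$ matrix whose $i$-th row is $(v_i)_{:,:n_0}$ (the first $n_0$ coordinates of $v_i$) has rank $n_0$.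
   Context: $[\![A_0,\dots,A_{D-1}]\!]$ denotes the tensor with $(i_0,\dots,i_{D-1})$ entry $\sum_{r}\prod_d (A_d)_{i_d,r}$; a rank-$R$ CPD uses $R$ columns in each $A_d$. Slices use 0-indexed NumPy notation: $M_{:,a:b}$ are columns $a,\dots,b-1$. For $v\in\mathbb{F}^{1\times m}$ and a tensor $S$ with first axis of length $m$, $v\times_0 S$ is the $(D-1)$-dimensional tensor with entries $\sum_i v_i S_{i,i_1,\dots,i_{D-1}}$. $\operatorname{rk}$ is tensor rank (least number of rank-1 tensors summing to it). $T$ is concise if each unfolding $T_{(d)}$ (rows = vectorized slices along axis $d$) has full row rank $n_d$. -}

module Defs where

open import Level using (Level; _⊔_)
open import Data.Nat as ℕ using (ℕ; zero; suc; _∸_; _<_; _≤_; _<?_)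
open import Data.Nat.Properties using (≤-trans; ≮⇒≥; ∸-monoˡ-<)
open import Data.Fin using (Fin; zero; suc; toℕ; fromℕ<; inject≤)
open import Data.Fin.Properties using (toℕ<n)
open import Data.Product using (Σ; ∃; _×_; _,_)
open import Relation.Nullary using (¬_; yes; no)
open import Algebra.Bundles using (CommutativeRing)

record Field (c ℓ : Level) : Set (Level.suc (c ⊔ ℓ)) where
  field
    commRing : CommutativeRing c ℓ
  open CommutativeRing commRing public
  field
    0≉1      : ¬ (0# ≈ 1#)
    inverse  : ∀ x → ¬ (x ≈ 0#) → Σ Carrier λ y → x * y ≈ 1#

module TensorDefs {c ℓ : Level} (𝔽 : Field c ℓ) where
  open Field 𝔽 public using (Carrier; _≈_)
  open Field 𝔽 using (_+_; _*_; -_; 0#; 1#)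

  Σ[<_] : (n : ℕ) → (Fin n → Carrier) → Carrier
  Σ[< zero ] f = 0#
  Σ[< suc n ] f = f zero + Σ[< n ] (λ i → f (suc i))

  Π[<_] : (n : ℕ) → (Fin n → Carrier) → Carrier
  Π[< zero ] f = 1#
  Π[< suc n ] f = f zero * Π[< n ] (λ i → f (suc i))

  Matrix : ℕ → ℕ → Set c
  Matrix m k = Fin m → Fin k → Carrier

  Idx : {D : ℕ} → (Fin D → ℕ) → Set
  Idx {D} ns = (d : Fin D) → Fin (ns d)

  upd : ∀ {D} {ns : Fin D → ℕ} → Idx ns → (d : Fin D) → Fin (ns d) → Idx ns
  upd {suc D} idx zero i zero = i
  upd {suc D} idx zero i (suc e) = idx (suc e)
  upd {suc D} idx (suc d) i zero = idx zero
  upd {suc D} {ns} idx (suc d) i (suc e) = upd {D} {λ x → ns (suc x)} (λ x → idx (suc x)) d i e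

  Tensor : {D : ℕ} → (Fin D → ℕ) → Set c
  Tensor ns = Idx ns → Carrier

  -- order-(1+D) tensor of size n0 × ns 0 × … × ns (D-1), curried on axis 0
  Tensor₀ : {D : ℕ} → ℕ → (Fin D → ℕ) → Set c
  Tensor₀ n0 ns = Fin n0 → Idx ns → Carrier

  FullRowRank : ∀ {m k} → Matrix m k → Set (c ⊔ ℓ)
  FullRowRank {m} {k} M =
    (coef : Fin m → Carrier) →
    (∀ j → Σ[< m ] (λ i → coef i * M i j) ≈ 0#) → ∀ i → coef i ≈ 0#

  -- full row rank of an unfolding whose columns are indexed by an
  -- arbitrary type J (the vectorized remaining multi-index)
  FullRowRankOn : ∀ {m} {J : Set} → (Fin m → J → Carrier) → Set (c ⊔ ℓ)
  FullRowRankOn {m} {J} M =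
    (coef : Fin m → Carrier) →
    (∀ j → Σ[< m ] (λ i → coef i * M i j) ≈ 0#) → ∀ i → coef i ≈ 0#

  Concise : ∀ {D n0} {ns : Fin D → ℕ} → Tensor₀ n0 ns → Set (c ⊔ ℓ)
  Concise {D} {n0} {ns} T =
    FullRowRankOn {n0} {Idx ns} T ×
    (∀ (d : Fin D) →
       FullRowRankOn {ns d} {Fin n0 × Idx ns}
         (λ i j → let (i0 , idx) = j in T i0 (upd idx d i)))

  _·_ : ∀ {m k p} → Matrix m k → Matrix k p → Matrix m p
  _·_ {k = k} M N i j = Σ[< k ] (λ l → M i l * N l j)

  I : ∀ {m} → Matrix m m
  I i j with toℕ i ℕ.≟ toℕ j
  ... | yes _ = 1#
  ... | no _  = 0#

  Invertible : ∀ {m} → Matrix m m → Set (c ⊔ ℓ)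
  Invertible {m} M = Σ (Matrix m m) λ N →
    (∀ i j → (M · N) i j ≈ I i j) × (∀ i j → (N · M) i j ≈ I i j)

  IsCPD : ∀ {D n0} {ns : Fin D → ℕ} (R : ℕ) →
          Tensor₀ n0 ns → Matrix n0 R → ((d : Fin D) → Matrix (ns d) R) →
          Set ℓ
  IsCPD {D} R T A0 A = ∀ i idx →
    T i idx ≈ Σ[< R ] (λ k → A0 i k * Π[< D ] (λ d → A d (idx d) k))

  -- rk X ≤ k for an order-D tensor X: X is a sum of k rank-1 tensors
  -- λ_t · a_{0,t} ⊗ … ⊗ a_{D-1,t} (the scalar λ_t only matters for D = 0).
  RankLE : ∀ {D} {ns : Fin D → ℕ} → Tensor ns → ℕ → Set (c ⊔ ℓ)
  RankLE {D} {ns} X k =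
    Σ (Fin k → Carrier) λ lam →
    Σ ((d : Fin D) → Matrix (ns d) k) λ A →
    ∀ idx → X idx ≈ Σ[< k ] (λ t → lam t * Π[< D ] (λ d → A d (idx d) t))

  _×₀_ : ∀ {D m} {ns : Fin D → ℕ} → (Fin m → Carrier) → Tensor₀ m ns → Tensor ns
  _×₀_ {m = m} v S idx = Σ[< m ] (λ i → v i * S i idx)

  extendT : ∀ {D n0} {ns : Fin D → ℕ} (r : ℕ) →
            Tensor₀ n0 ns → ((d : Fin D) → Matrix (ns d) (r ∸ n0)) →
            Tensor₀ r ns
  extendT {D} {n0} r T B r' idx with toℕ r' <? n0
  ... | yes p = T (fromℕ< p) idx
  ... | no ¬p = - Π[< D ] (λ d → B d (idx d)
                   (fromℕ< (∸-monoˡ-< (toℕ<n r') (≮⇒≥ ¬p))))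

-- Let N be the inverse of the leading n0 × n0 block of A0 and C = N A0, so
-- that contracting T with row i of N yields the CPD with coefficient row C_i,
-- whose first n0 entries form the i-th unit vector. Extend that row by the
-- entries of C_i in columns n0, …, r-1: against the extra slices
-- −⊗_d (B_d)_{:,k} = −⊗_d (A_d)_{:,n0+k} of T' they cancel exactly these
-- columns of the CPD, leaving the rank-one term of column i plus the R − r
-- columns r, …, R-1. The leading coordinates of these vectors are the rows of
-- the invertible N.
module Submission where

open import Defs
open import Level using (Level)
open import Data.Nat as ℕ using (ℕ; zero; suc; _∸_; _≤_; _<_; _<?_; z≤n; s≤s)
open import Data.Nat.Properties using (≤-trans; ≮⇒≥; ∸-monoˡ-<; m+n≮m; m+n∸m≡n)
open import Data.Fin using (Fin; zero; suc; toℕ; inject≤; fromℕ<; _↑ˡ_; _↑ʳ_; punchIn)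
open import Data.Fin.Properties
  using (toℕ-injective; toℕ-fromℕ<; toℕ-inject≤; toℕ<n; inject≤-trans; punchInᵢ≢i)
open import Data.Vec.Functional using (_++_)
open import Data.Vec.Functional.Properties using (lookup-++ˡ; lookup-++ʳ)
open import Data.Product using (Σ; _×_; _,_)
open import Function using (_∘_; flip)
open import Relation.Binary.PropositionalEquality as ≡ using (_≡_; _≢_)
open import Relation.Nullary using (yes; no)
open import Relation.Nullary.Negation using (contradiction)
import Relation.Binary.Reasoning.Setoid as SetoidReasoning

private
  variable
    a : Level
    A : Set a
    m n : ℕ

shift≤ : m ≤ n → Fin (n ∸ m) → Fin n
shift≤ z≤n     k = k
shift≤ (s≤s p) k = suc (shift≤ p k)

toℕ-shift≤ : (m≤n : m ≤ n) (k : Fin (n ∸ m)) → toℕ (shift≤ m≤n k) ≡ m ℕ.+ toℕ k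
toℕ-shift≤ z≤n     k = ≡.refl
toℕ-shift≤ (s≤s p) k = ≡.cong suc (toℕ-shift≤ p k)

-- The block vector (x ∣ y), split by the same test as the rows of extendT.
glue : (Fin m → A) → (Fin (n ∸ m) → A) → Fin n → A
glue {m = m} x y k with toℕ k <? m
... | yes k<m = x (fromℕ< k<m)
... | no k≮m  = y (fromℕ< (∸-monoˡ-< (toℕ<n k) (≮⇒≥ k≮m)))

glue-inject≤ : (x : Fin m → A) (y : Fin (n ∸ m) → A) (m≤n : m ≤ n) (j : Fin m) →
               glue x y (inject≤ j m≤n) ≡ x j
glue-inject≤ {m = m} x y m≤n j with toℕ (inject≤ j m≤n) <? m
... | yes p = ≡.cong x (toℕ-injective (≡.trans (toℕ-fromℕ< p) (toℕ-inject≤ j m≤n)))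
... | no ¬p = contradiction (≡.subst (_< m) (≡.sym (toℕ-inject≤ j m≤n)) (toℕ<n j)) ¬p

glue-shift≤ : (x : Fin m → A) (y : Fin (n ∸ m) → A) (m≤n : m ≤ n) (k : Fin (n ∸ m)) →
              glue x y (shift≤ m≤n k) ≡ y k
glue-shift≤ {m = m} x y m≤n k with toℕ (shift≤ m≤n k) <? m
... | yes p = contradiction (≡.subst (_< m) (toℕ-shift≤ m≤n k) p) (m+n≮m m (toℕ k))
... | no _  = ≡.cong y (toℕ-injective (≡.trans (toℕ-fromℕ< _)
                (≡.trans (≡.cong (_∸ m) (toℕ-shift≤ m≤n k)) (m+n∸m≡n m (toℕ k)))))

module FiniteSums {c ℓ} (𝔽 : Field c ℓ) where
  open Field 𝔽 hiding (Carrier; _≈_; zero)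
  open TensorDefs 𝔽
  open import Algebra.Properties.Semiring.Sum semiring
    using (sum; sum-cong-≋; sum-cong-≗; sum-replicate-zero; sum-remove; ∑-distrib-+; ∑-comm;
           *-distribˡ-sum; *-distribʳ-sum)
  open import Algebra.Properties.Monoid.Sum *-monoid
    using () renaming (sum to product; sum-cong-≋ to product-cong-≋)
  open SetoidReasoning setoid

  Σ≡sum : (f : Fin n → Carrier) → Σ[< n ] f ≡ sum f
  Σ≡sum {zero}  f = ≡.refl
  Σ≡sum {suc n} f = ≡.cong (f zero +_) (Σ≡sum (f ∘ suc))

  Π≡product : (f : Fin n → Carrier) → Π[< n ] f ≡ product f
  Π≡product {zero}  f = ≡.refl
  Π≡product {suc n} f = ≡.cong (f zero *_) (Π≡product (f ∘ suc))

  -- Σ[< n ] is not injective in n, so callers often have to supply n.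
  Σ-cong : ∀ {n} {f g : Fin n → Carrier} → (∀ i → f i ≈ g i) → Σ[< n ] f ≈ Σ[< n ] g
  Σ-cong {f = f} {g = g} f≈g rewrite Σ≡sum f | Σ≡sum g = sum-cong-≋ f≈g

  Π-cong : ∀ {n} {f g : Fin n → Carrier} → (∀ i → f i ≈ g i) → Π[< n ] f ≈ Π[< n ] g
  Π-cong {f = f} {g = g} f≈g rewrite Π≡product f | Π≡product g = product-cong-≋ f≈g

  Σ-zero : {f : Fin n → Carrier} → (∀ i → f i ≈ 0#) → Σ[< n ] f ≈ 0#
  Σ-zero {n = n} f≈0 =
    trans (Σ-cong f≈0) (trans (reflexive (Σ≡sum {n} (λ _ → 0#))) (sum-replicate-zero n))

  Σ-distrib-+ : (f g : Fin n → Carrier) →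
                Σ[< n ] (λ i → f i + g i) ≈ Σ[< n ] f + Σ[< n ] g
  Σ-distrib-+ f g rewrite Σ≡sum (λ i → f i + g i) | Σ≡sum f | Σ≡sum g = ∑-distrib-+ f g

  *-distribˡ-Σ : ∀ x (f : Fin n → Carrier) → x * Σ[< n ] f ≈ Σ[< n ] (λ i → x * f i)
  *-distribˡ-Σ x f rewrite Σ≡sum f | Σ≡sum (λ i → x * f i) = *-distribˡ-sum x f

  *-distribʳ-Σ : ∀ x (f : Fin n → Carrier) → Σ[< n ] f * x ≈ Σ[< n ] (λ i → f i * x)
  *-distribʳ-Σ x f rewrite Σ≡sum f | Σ≡sum (λ i → f i * x) = *-distribʳ-sum x f

  Σ-comm : ∀ {m n} (f : Fin m → Fin n → Carrier) →
           Σ[< m ] (λ i → Σ[< n ] (f i)) ≈ Σ[< n ] (λ j → Σ[< m ] (λ i → f i j))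
  Σ-comm {m} {n} f = begin
    Σ[< m ] (λ i → Σ[< n ] (f i))          ≡⟨ Σ²≡sum² f ⟩
    sum (λ i → sum (f i))                  ≈⟨ ∑-comm f ⟩
    sum (λ j → sum (λ i → f i j))          ≡⟨ Σ²≡sum² (flip f) ⟨
    Σ[< n ] (λ j → Σ[< m ] (λ i → f i j))  ∎
    where
    Σ²≡sum² : ∀ {m n} (h : Fin m → Fin n → Carrier) →
              Σ[< m ] (λ i → Σ[< n ] (h i)) ≡ sum (λ i → sum (h i))
    Σ²≡sum² h = ≡.trans (Σ≡sum (λ i → Σ[< _ ] (h i))) (sum-cong-≗ (Σ≡sum ∘ h))

  Σ-*-Σ-swap : (x : Fin m → Carrier) (M : Matrix m n) (y : Fin n → Carrier) →
               Σ[< m ] (λ i → x i * Σ[< n ] (λ j → M i j * y j)) ≈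
               Σ[< n ] (λ j → Σ[< m ] (λ i → x i * M i j) * y j)
  Σ-*-Σ-swap {m} {n} x M y = begin
    Σ[< m ] (λ i → x i * Σ[< n ] (λ j → M i j * y j))
      ≈⟨ Σ-cong {m} (λ i → *-distribˡ-Σ (x i) (λ j → M i j * y j)) ⟩
    Σ[< m ] (λ i → Σ[< n ] (λ j → x i * (M i j * y j)))
      ≈⟨ Σ-cong {m} (λ i → Σ-cong {n} (λ j → *-assoc (x i) (M i j) (y j))) ⟨
    Σ[< m ] (λ i → Σ[< n ] (λ j → x i * M i j * y j))
      ≈⟨ Σ-comm {m} {n} _ ⟩
    Σ[< n ] (λ j → Σ[< m ] (λ i → x i * M i j * y j))
      ≈⟨ Σ-cong {n} (λ j → *-distribʳ-Σ (y j) (λ i → x i * M i j)) ⟨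
    Σ[< n ] (λ j → Σ[< m ] (λ i → x i * M i j) * y j)
      ∎

  Σ-*-neg-cancel : (x y : Fin n → Carrier) →
                   Σ[< n ] (λ k → x k * y k) + Σ[< n ] (λ k → x k * - y k) ≈ 0#
  Σ-*-neg-cancel x y =
    trans (sym (Σ-distrib-+ (λ k → x k * y k) (λ k → x k * - y k))) (Σ-zero λ k → begin
      x k * y k + x k * - y k  ≈⟨ distribˡ (x k) (y k) (- y k) ⟨
      x k * (y k + - y k)      ≈⟨ *-congˡ (-‿inverseʳ (y k)) ⟩
      x k * 0#                 ≈⟨ zeroʳ (x k) ⟩
      0#                       ∎)

  Σ-++ : (f : Fin (m ℕ.+ n) → Carrier) →
         Σ[< m ℕ.+ n ] f ≈ Σ[< m ] (f ∘ (_↑ˡ n)) + Σ[< n ] (f ∘ (m ↑ʳ_))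
  Σ-++ {zero}  f = sym (+-identityˡ _)
  Σ-++ {suc m} {n} f = trans (+-congˡ (Σ-++ {m} {n} (f ∘ suc))) (sym (+-assoc _ _ _))

  Σ-split≤ : (m≤n : m ≤ n) (f : Fin n → Carrier) →
             Σ[< n ] f ≈ Σ[< m ] (λ j → f (inject≤ j m≤n)) + Σ[< n ∸ m ] (f ∘ shift≤ m≤n)
  Σ-split≤ z≤n     f = sym (+-identityˡ _)
  Σ-split≤ (s≤s p) f = trans (+-congˡ (Σ-split≤ p (f ∘ suc))) (sym (+-assoc _ _ _))

  Σ-single : (f : Fin n → Carrier) (i : Fin n) → (∀ j → j ≢ i → f j ≈ 0#) → Σ[< n ] f ≈ f i
  Σ-single {suc n} f i off-i≈0 = begin
    Σ[< suc n ] f             ≡⟨ Σ≡sum f ⟩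
    sum f                     ≈⟨ sum-remove f ⟩
    f i + sum (f ∘ punchIn i) ≈⟨ +-congˡ (trans (sum-cong-≋ λ j → off-i≈0 _ (punchInᵢ≢i i j))
                                                (sum-replicate-zero n)) ⟩
    f i + 0#                  ≈⟨ +-identityʳ (f i) ⟩
    f i                       ∎

module Matrices {c ℓ} (𝔽 : Field c ℓ) where
  open Field 𝔽 hiding (Carrier; _≈_; zero)
  open TensorDefs 𝔽
  open FiniteSums 𝔽
  open SetoidReasoning setoid

  I-diagonal : (i : Fin n) → I i i ≈ 1#
  I-diagonal i with toℕ i ℕ.≟ toℕ i
  ... | yes _   = refl
  ... | no i≢i = contradiction ≡.refl i≢i

  I-off-diagonal : {i j : Fin n} → i ≢ j → I i j ≈ 0#
  I-off-diagonal {i = i} {j} i≢j with toℕ i ℕ.≟ toℕ j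
  ... | yes i≡j = contradiction (toℕ-injective i≡j) i≢j
  ... | no _    = refl

  Σ-I-*ˡ : (i : Fin n) (f : Fin n → Carrier) → Σ[< n ] (λ j → I i j * f j) ≈ f i
  Σ-I-*ˡ i f = trans
    (Σ-single _ i λ j j≢i → trans (*-congʳ (I-off-diagonal (j≢i ∘ ≡.sym))) (zeroˡ (f j)))
    (trans (*-congʳ (I-diagonal i)) (*-identityˡ (f i)))

  Σ-*-Iʳ : (i : Fin n) (f : Fin n → Carrier) → Σ[< n ] (λ j → f j * I j i) ≈ f i
  Σ-*-Iʳ i f = trans
    (Σ-single _ i λ j j≢i → trans (*-congˡ (I-off-diagonal j≢i)) (zeroʳ (f j)))
    (trans (*-congˡ (I-diagonal i)) (*-identityʳ (f i)))

  FullRowRank-resp : {M M′ : Matrix m n} → (∀ i j → M i j ≈ M′ i j) →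
                     FullRowRank M → FullRowRank M′
  FullRowRank-resp {m = m} M≈M′ rank-M coef coef·M′≈0 =
    rank-M coef λ j → trans (Σ-cong {m} λ i → *-congˡ (M≈M′ i j)) (coef·M′≈0 j)

  ·≈I⇒FullRowRank : {M : Matrix m n} {N : Matrix n m} → (∀ i j → (M · N) i j ≈ I i j) →
                    FullRowRank M
  ·≈I⇒FullRowRank {m = m} {n} {M} {N} M·N≈I coef coef·M≈0 k = begin
    coef k
      ≈⟨ Σ-*-Iʳ k coef ⟨
    Σ[< m ] (λ i → coef i * I i k)
      ≈⟨ Σ-cong {m} (λ i → *-congˡ (M·N≈I i k)) ⟨
    Σ[< m ] (λ i → coef i * (M · N) i k)
      ≈⟨ Σ-*-Σ-swap coef M (λ j → N j k) ⟩
    Σ[< n ] (λ j → Σ[< m ] (λ i → coef i * M i j) * N j k)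
      ≈⟨ Σ-zero coef·M·N≈0 ⟩
    0#
      ∎
    where
    coef·M·N≈0 : ∀ j → Σ[< m ] (λ i → coef i * M i j) * N j k ≈ 0#
    coef·M·N≈0 j = trans (*-congʳ (coef·M≈0 j)) (zeroˡ (N j k))

module CPD {c ℓ} (𝔽 : Field c ℓ) where
  open Field 𝔽 hiding (Carrier; _≈_; zero)
  open TensorDefs 𝔽
  open FiniteSums 𝔽
  open Matrices 𝔽
  open SetoidReasoning setoid
  open import Algebra.Solver.CommutativeMonoid +-commutativeMonoid using (solve; _⊕_; _⊜_)

  private
    variable
      D k n0 r R : ℕ
      ns : Fin D → ℕ

  -- In these terms RankLE X k unfolds to ∃ lam A. ∀ idx → X idx ≈ cpd lam A idx,
  -- and IsCPD R T A0 A to ∀ i idx → T i idx ≈ cpd (A0 i) A idx.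
  rank1 : ((d : Fin D) → Matrix (ns d) k) → Fin k → Tensor ns
  rank1 {D} A t idx = Π[< D ] (λ d → A d (idx d) t)

  cpd : (Fin k → Carrier) → ((d : Fin D) → Matrix (ns d) k) → Tensor ns
  cpd {k} lam A idx = Σ[< k ] (λ t → lam t * rank1 A t idx)

  RankLE-resp : {X Y : Tensor ns} → (∀ idx → X idx ≈ Y idx) → RankLE X k → RankLE Y k
  RankLE-resp X≈Y (lam , A , X≈cpd) = lam , A , λ idx → trans (sym (X≈Y idx)) (X≈cpd idx)

  RankLE-rank1 : (A : (d : Fin D) → Matrix (ns d) k) (t : Fin k) → RankLE (rank1 A t) 1
  RankLE-rank1 A t = (λ _ → 1#) , (λ d x _ → A d x t) ,
                     λ idx → sym (trans (+-identityʳ _) (*-identityˡ _))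

  cpd-++ : ∀ {m n} (lam : Fin m → Carrier) (lam′ : Fin n → Carrier)
           (A : (d : Fin D) → Matrix (ns d) m) (A′ : (d : Fin D) → Matrix (ns d) n)
           (idx : Idx ns) →
           cpd (lam ++ lam′) (λ d x → A d x ++ A′ d x) idx ≈ cpd lam A idx + cpd lam′ A′ idx
  cpd-++ {D} {m = m} {n} lam lam′ A A′ idx = trans (Σ-++ {m} {n} _) (+-cong
    (Σ-cong {m} λ t → *-cong (reflexive (lookup-++ˡ lam lam′ t))
      (Π-cong {D} λ d → reflexive (lookup-++ˡ (A d (idx d)) (A′ d (idx d)) t)))
    (Σ-cong {n} λ t → *-cong (reflexive (lookup-++ʳ lam lam′ t))
      (Π-cong {D} λ d → reflexive (lookup-++ʳ (A d (idx d)) (A′ d (idx d)) t))))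

  RankLE-+ : ∀ {m n} {X Y : Tensor ns} → RankLE X m → RankLE Y n →
             RankLE (λ idx → X idx + Y idx) (m ℕ.+ n)
  RankLE-+ (lam , A , X≈) (lam′ , A′ , Y≈) =
    lam ++ lam′ , (λ d x → A d x ++ A′ d x) ,
    λ idx → trans (+-cong (X≈ idx) (Y≈ idx)) (sym (cpd-++ lam lam′ A A′ idx))

  ×₀-IsCPD : ∀ {m} {T : Tensor₀ n0 ns} {A0 : Matrix n0 R} {A} → IsCPD R T A0 A →
             (N : Matrix m n0) → IsCPD R (λ i → N i ×₀ T) (N · A0) A
  ×₀-IsCPD {n0 = n0} {R = R} {T = T} {A0} {A} T≈cpd N i idx = begin
    Σ[< n0 ] (λ j → N i j * T j idx)           ≈⟨ Σ-cong {n0} (λ j → *-congˡ (T≈cpd j idx)) ⟩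
    Σ[< n0 ] (λ j → N i j * cpd (A0 j) A idx)  ≈⟨ Σ-*-Σ-swap (N i) A0 (λ t → rank1 A t idx) ⟩
    cpd ((N · A0) i) A idx                     ∎

  extendT-glue : (T : Tensor₀ n0 ns) (B : (d : Fin D) → Matrix (ns d) (r ∸ n0))
                 (k : Fin r) (idx : Idx ns) →
                 extendT r T B k idx ≡ glue (λ j → T j idx) (λ k′ → - rank1 B k′ idx) k
  extendT-glue {n0 = n0} T B k idx with toℕ k <? n0
  ... | yes _ = ≡.refl
  ... | no _  = ≡.refl

  ×₀-extendT : {T : Tensor₀ n0 ns} {B : (d : Fin D) → Matrix (ns d) (r ∸ n0)} →
               (n0≤r : n0 ≤ r) (v : Fin r → Carrier) (idx : Idx ns) →
               (v ×₀ extendT r T B) idx ≈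
               ((λ j → v (inject≤ j n0≤r)) ×₀ T) idx +
               Σ[< r ∸ n0 ] (λ k → v (shift≤ n0≤r k) * - rank1 B k idx)
  ×₀-extendT {n0 = n0} {r = r} {T = T} {B} n0≤r v idx =
    trans (Σ-split≤ n0≤r _) (+-cong
      (Σ-cong {n0} λ j → *-congˡ (reflexive (≡.trans (extendT-glue T B _ idx)
                                                      (glue-inject≤ _ _ n0≤r j))))
      (Σ-cong {r ∸ n0} λ k → *-congˡ (reflexive (≡.trans (extendT-glue T B _ idx)
                                                          (glue-shift≤ _ _ n0≤r k)))))

  module LowRankContractions
    {T : Tensor₀ n0 ns} {A0 : Matrix n0 R} {A : (d : Fin D) → Matrix (ns d) R}
    {B : (d : Fin D) → Matrix (ns d) (r ∸ n0)} {N : Matrix n0 n0}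
    (n0≤r : n0 ≤ r) (r≤R : r ≤ R) (T≈cpd : IsCPD R T A0 A)
    (N·A0≈I : ∀ i j → (N · (λ i k → A0 i (inject≤ k (≤-trans n0≤r r≤R)))) i j ≈ I i j)
    (A≈B : ∀ (d : Fin D) (i : Fin (ns d)) (j : Fin R) (k : Fin (r ∸ n0)) →
           toℕ j ≡ n0 ℕ.+ toℕ k → A d i j ≈ B d i k) where

    C : Matrix n0 R
    C = N · A0

    low : Fin n0 → Fin R
    low j = inject≤ (inject≤ j n0≤r) r≤R

    mid : Fin (r ∸ n0) → Fin R
    mid k = inject≤ (shift≤ n0≤r k) r≤R

    high : Fin (R ∸ r) → Fin R
    high = shift≤ r≤R

    A-high : (d : Fin D) → Matrix (ns d) (R ∸ r)
    A-high d x = A d x ∘ high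

    C-low : ∀ i j → C i (low j) ≈ I i j
    C-low i j = trans (reflexive (≡.cong (C i) (inject≤-trans j n0≤r r≤R))) (N·A0≈I i j)

    A-mid : ∀ k idx → rank1 A (mid k) idx ≈ rank1 B k idx
    A-mid k idx = Π-cong {D} λ d →
      A≈B d (idx d) (mid k) k (≡.trans (toℕ-inject≤ _ r≤R) (toℕ-shift≤ n0≤r k))

    N×₀T≈cpd : IsCPD R (λ i → N i ×₀ T) C A
    N×₀T≈cpd = ×₀-IsCPD {R = R} {A0 = A0} {A = A} T≈cpd N

    v : Fin n0 → Fin r → Carrier
    v i = glue (N i) (C i ∘ mid)

    v-low : ∀ i j → v i (inject≤ j n0≤r) ≡ N i j
    v-low i = glue-inject≤ (N i) (C i ∘ mid) n0≤r

    v-mid : ∀ i k → v i (shift≤ n0≤r k) ≡ C i (mid k)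
    v-mid i = glue-shift≤ (N i) (C i ∘ mid) n0≤r

    cpd-blocks : ∀ i idx →
      cpd (C i) A idx ≈
      (rank1 A (low i) idx + Σ[< r ∸ n0 ] (λ k → C i (mid k) * rank1 B k idx)) +
      cpd (C i ∘ high) A-high idx
    cpd-blocks i idx = begin
      cpd (C i) A idx
        ≈⟨ Σ-split≤ r≤R _ ⟩
      Σ[< r ] (λ k → C i (inject≤ k r≤R) * rank1 A (inject≤ k r≤R) idx) + W
        ≈⟨ +-congʳ (Σ-split≤ n0≤r _) ⟩
      (Σ[< n0 ] (λ j → C i (low j) * rank1 A (low j) idx) +
       Σ[< r ∸ n0 ] (λ k → C i (mid k) * rank1 A (mid k) idx)) + W
        ≈⟨ +-congʳ (+-cong low-block (Σ-cong {r ∸ n0} λ k → *-congˡ (A-mid k idx))) ⟩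
      (rank1 A (low i) idx + Σ[< r ∸ n0 ] (λ k → C i (mid k) * rank1 B k idx)) + W
        ∎
      where
      W : Carrier
      W = cpd (C i ∘ high) A-high idx
      low-block : Σ[< n0 ] (λ j → C i (low j) * rank1 A (low j) idx) ≈ rank1 A (low i) idx
      low-block = trans (Σ-cong {n0} λ j → *-congʳ (C-low i j))
                        (Σ-I-*ˡ i (λ j → rank1 A (low j) idx))

    v×₀extendT≈ : ∀ i idx →
      (v i ×₀ extendT r T B) idx ≈
      cpd (C i ∘ high) A-high idx + rank1 A (low i) idx
    v×₀extendT≈ i idx = begin
      (v i ×₀ extendT r T B) idx
        ≈⟨ ×₀-extendT n0≤r (v i) idx ⟩
      ((λ j → v i (inject≤ j n0≤r)) ×₀ T) idx +
      Σ[< r ∸ n0 ] (λ k → v i (shift≤ n0≤r k) * - rank1 B k idx)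
        ≈⟨ +-cong (Σ-cong {n0} λ j → *-congʳ (reflexive (v-low i j)))
                  (Σ-cong {r ∸ n0} λ k → *-congʳ (reflexive (v-mid i k))) ⟩
      (N i ×₀ T) idx + Z
        ≈⟨ +-congʳ (N×₀T≈cpd i idx) ⟩
      cpd (C i) A idx + Z
        ≈⟨ +-congʳ (cpd-blocks i idx) ⟩
      ((H + Y) + W) + Z
        ≈⟨ solve 4 (λ h y w z → ((h ⊕ y) ⊕ w) ⊕ z ⊜ (w ⊕ h) ⊕ (y ⊕ z)) refl H Y W Z ⟩
      (W + H) + (Y + Z)
        ≈⟨ +-congˡ (Σ-*-neg-cancel (C i ∘ mid) (λ k → rank1 B k idx)) ⟩
      (W + H) + 0#
        ≈⟨ +-identityʳ (W + H) ⟩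
      W + H
        ∎
      where
      H Y Z W : Carrier
      H = rank1 A (low i) idx
      Y = Σ[< r ∸ n0 ] (λ k → C i (mid k) * rank1 B k idx)
      Z = Σ[< r ∸ n0 ] (λ k → C i (mid k) * - rank1 B k idx)
      W = cpd (C i ∘ high) A-high idx

    v-RankLE : ∀ i → RankLE (v i ×₀ extendT r T B) (R ∸ r ℕ.+ 1)
    v-RankLE i = RankLE-resp (λ idx → sym (v×₀extendT≈ i idx))
      (RankLE-+ (C i ∘ high , A-high , λ _ → refl) (RankLE-rank1 A (low i)))

    v-FullRowRank : FullRowRank (λ (i k : Fin n0) → v i (inject≤ k n0≤r))
    v-FullRowRank =
      FullRowRank-resp (λ i k → reflexive (≡.sym (v-low i k))) (·≈I⇒FullRowRank N·A0≈I)

-- Imported only here: in the modules above, _+_ is the field addition.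
open import Data.Nat using (_+_)

lemma3 : ∀ {c ℓ : Level} (𝔽 : Field c ℓ) → let open TensorDefs 𝔽 in
    (D n0 : ℕ) (ns : Fin D → ℕ) (T : Tensor₀ n0 ns) → Concise T →
    (R r : ℕ) (n0≤r : n0 ≤ r) (r≤R : r ≤ R) →
    (B : (d : Fin D) → Matrix (ns d) (r ∸ n0)) →
    Σ (Matrix n0 R) (λ A0 → Σ ((d : Fin D) → Matrix (ns d) R) λ A →
        IsCPD R T A0 A
        × Invertible (λ i k → A0 i (inject≤ k (≤-trans n0≤r r≤R)))
        × (∀ (d : Fin D) (i : Fin (ns d)) (j : Fin R) (k : Fin (r ∸ n0)) →
             toℕ j ≡ n0 + toℕ k → A d i j ≈ B d i k)) →
    Σ (Fin n0 → Fin r → Carrier) λ v →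
      (∀ (i : Fin n0) → RankLE (v i ×₀ extendT r T B) (R ∸ r + 1))
      × FullRowRank (λ (i k : Fin n0) → v i (inject≤ k n0≤r))
lemma3 𝔽 D n0 ns T _ R r n0≤r r≤R B (A0 , A , T≈cpd , (N , _ , N·A0≈I) , A≈B) =
  v , v-RankLE , v-FullRowRank
  where open CPD.LowRankContractions 𝔽 n0≤r r≤R T≈cpd N·A0≈I A≈B
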